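{- For every directed acyclic multigraph $G$ with single source $s$ and single sink $t$, $$\mathrm{width}(G)=\min\{\mathrm{fwidth}(G,f)\mid f>0\}\quad\text{and}\quad \mathrm{pw}(G)=\max\{\mathrm{fwidth}(G,f)\mid f\ge 0\},$$ where $f$ ranges over non-negative integer flows on $G$, and $f>0$ means $f(e)>0$ for every edge $e$.
   Context: Graphs are directed acyclic multigraphs with a single source $s$ and single sink $t$, every edge lying on some $s$-$t$ path. A flow is $f:E(G)\to\mathbb{N}$ with conservation at all vertices other than $s,t$. $\mathrm{width}(G)$ is the minimum number of $s$-$t$ paths covering all edges. The flow-width $\mathrm{fwidth}(G,f)$ is the smallest number of $s$-$t$ paths such that every edge with $f(e)>0$ lies on at least one path and every edge $e$ lies on at most $f(e)$ paths. A cut-set is a set of edges whose removal disconnects $s$ from $t$; the parallel-width $\mathrm{pw}(G)$ is the largest size of an inclusion-minimal cut-set of $G$. -}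

module Defs where

open import Data.Nat using (ℕ; zero; suc; _+_; _≤_; _<_)
open import Data.Fin using (Fin)
open import Data.Fin.Properties using (_≟_)
open import Data.Fin.Subset using (Subset; _⊂_; ∣_∣) renaming (_∈_ to _∈ₛ_)
open import Data.List using (List; []; _∷_; length; filter; map; allFin)
open import Data.Nat.ListAction using (sum)
open import Data.List.Membership.Propositional using (_∈_)
open import Data.List.Relation.Unary.Any using (Any)
open import Data.Product using (Σ; ∃; _×_; _,_)
open import Relation.Binary.PropositionalEquality using (_≡_; _≢_)
open import Relation.Nullary using (¬_)

-- A finite directed multigraph: vertices Fin n, edges Fin m, each edge
-- e goes from tl e to hd e (parallel edges allowed), with distinguished s, t.
record Graph : Set where
  field
    n m : ℕ
    tl hd : Fin m → Fin n
    s t : Fin n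

module _ (G : Graph) where
  open Graph G
  open import Data.List.Membership.DecPropositional (_≟_ {n = m}) using (_∈?_)

  data Path : Fin n → Fin n → Set where
    []  : ∀ {v} → Path v v
    _∷_ : ∀ {v} (e : Fin m) → Path (hd e) v → Path (tl e) v

  edges : ∀ {u v} → Path u v → List (Fin m)
  edges []       = []
  edges (e ∷ p) = e ∷ edges p

  STPath : Set
  STPath = Path s t

  Acyclic : Set
  Acyclic = ∀ v (p : Path v v) → length (edges p) ≡ 0

  SingleSource : Set
  SingleSource = (∀ e → hd e ≢ s) × (∀ v → (∀ e → hd e ≢ v) → v ≡ s)

  SingleSink : Set
  SingleSink = (∀ e → tl e ≢ t) × (∀ v → (∀ e → tl e ≢ v) → v ≡ t)

  EveryEdgeOnSTPath : Set
  EveryEdgeOnSTPath = ∀ e → Σ STPath λ p → e ∈ edges p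

  -- the standing assumptions on G (s ≠ t excludes the one-vertex edgeless graph)
  IsSTDAG : Set
  IsSTDAG = Acyclic × SingleSource × SingleSink × EveryEdgeOnSTPath × s ≢ t

  inflow : (Fin m → ℕ) → Fin n → ℕ
  inflow f v = sum (map f (filter (λ e → hd e ≟ v) (allFin m)))

  outflow : (Fin m → ℕ) → Fin n → ℕ
  outflow f v = sum (map f (filter (λ e → tl e ≟ v) (allFin m)))

  IsFlow : (Fin m → ℕ) → Set
  IsFlow f = ∀ v → v ≢ s → v ≢ t → inflow f v ≡ outflow f v

  Positive : (Fin m → ℕ) → Set
  Positive f = ∀ e → 0 < f e

  onCount : Fin m → List STPath → ℕ
  onCount e ps = length (filter (λ p → e ∈? edges p) ps)

  Covers : List STPath → Set
  Covers ps = ∀ e → Any (λ p → e ∈ edges p) ps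

  IsWidth : ℕ → Set
  IsWidth w = (Σ (List STPath) λ ps → Covers ps × length ps ≡ w)
            × (∀ ps → Covers ps → w ≤ length ps)

  FlowCover : (Fin m → ℕ) → List STPath → Set
  FlowCover f ps = ∀ e → (0 < f e → Any (λ p → e ∈ edges p) ps) × onCount e ps ≤ f e

  IsFwidth : (Fin m → ℕ) → ℕ → Set
  IsFwidth f k = (Σ (List STPath) λ ps → FlowCover f ps × length ps ≡ k)
               × (∀ ps → FlowCover f ps → k ≤ length ps)

  -- cut-sets: removing C leaves no s-t path, i.e. every s-t path uses an edge of C
  IsCutSet : Subset m → Set
  IsCutSet C = ∀ (p : STPath) → Σ (Fin m) λ e → e ∈ edges p × e ∈ₛ C

  IsMinimalCutSet : Subset m → Set
  IsMinimalCutSet C = IsCutSet C × (∀ D → D ⊂ C → ¬ IsCutSet D)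

  IsParallelWidth : ℕ → Set
  IsParallelWidth k = (Σ (Subset m) λ C → IsMinimalCutSet C × ∣ C ∣ ≡ k)
                    × (∀ C → IsMinimalCutSet C → ∣ C ∣ ≤ k)

{-# OPTIONS --safe #-}
module Submission where

-- Families of s-t paths and flows are two views of the same object: the multiplicity
-- function e ↦ onCount e ps of a family is a flow of value length ps, and, G being acyclic,
-- every flow of value K is the multiplicity function of K s-t paths (follow positive edges
-- from s to t, subtract that path, repeat). For positive flows, flow covers are just
-- covers, so the multiplicity function of a minimum cover has fwidth width(G), and no
-- positive flow has smaller fwidth.
-- For pw, let qs realise fwidth(G,f) and let g be its multiplicity function. If some s-t
-- path has g ≥ 2 on all its edges, subtracting it from g and decomposing the rest yields a
-- smaller flow cover of f. Otherwise the edges entering the set of vertices that reach t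
-- along such edges form a cut on which g ≤ 1; a minimal cut C inside it is met by every
-- path of qs, so fwidth(G,f) ≤ |C| ≤ pw(G). Conversely, for a minimal cut C choose, for
-- each e ∈ C, an s-t path meeting C only in e. Any s-t path using only edges of these paths
-- still meets C at most once, so the multiplicity function of the chosen paths has
-- fwidth exactly |C|.

open import Defs
open import Level using (Level)
open import Function using (_∘_; id; _⇔_; mk⇔)
open import Data.Bool.Base using (true; false)
open import Data.Empty using (⊥-elim)
open import Data.Product using (Σ; _×_; _,_; proj₁; proj₂)
open import Data.Sum using (_⊎_; inj₁; inj₂)
open import Data.Nat.Base using (ℕ; zero; suc; _+_; _*_; _∸_; _≤_; _<_; z≤n; s≤s; s≤s⁻¹; z<s)
open import Data.Nat.Properties
  using ( ≤-refl; ≤-reflexive; ≤-trans; <⇒≤; <⇒≱; ≮⇒≥; ≰⇒>; >⇒≢; ≤∧≢⇒<; n≤0⇒n≡0; _≤?_; anyUpTo?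
        ; module ≤-Reasoning; +-comm; +-assoc; +-suc; +-identityʳ; *-identityʳ; *-zeroʳ; +-cancelʳ-≡
        ; suc-injective; +-mono-≤; m≤m+n; m≤n+m; m∸n≤m; m∸n+n≡m; m+[n∸m]≡n; m<n⇒0<n∸m
        ; +-commutativeSemigroup)
import Data.Nat.Properties as ℕₚ
open import Data.Nat.Induction using (<-wellFounded)
open import Data.Nat.ListAction using (sum)
open import Algebra.Properties.CommutativeSemigroup +-commutativeSemigroup using (interchange)
open import Data.Fin.Base using (Fin; zero; suc)
open import Data.Fin.Properties using (_≟_)
import Data.Fin.Properties as Finₚ
open import Data.Fin.Subset using (Subset; _⊆_; ∣_∣; ⊤; _-_; inside; outside)
  renaming (_∈_ to _∈ₛ_; _∉_ to _∉ₛ_)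
open import Data.Fin.Subset.Properties
  using (anySubset?; _⊂?_; p⊂q⇒∣p∣<∣q∣; p⊂q⇒p⊆q; ∣p∣≤n; ∈⊤; x∈p⇒p-x⊂p; x∈p∧x≢y⇒x∈p-y)
  renaming (_∈?_ to _∈ₛ?_)
import Data.Vec.Base as Vec
open import Data.Vec.Base using ([]; _∷_)
open import Data.Vec.Properties using (lookup∘tabulate; []=⇒lookup; lookup⇒[]=)
open import Data.List.Base
  using (List; []; _∷_; _++_; length; map; filter; allFin; tabulate; concatMap; cartesianProductWith)
open import Data.List.Properties
  using (map-cong; map-tabulate; length-tabulate; length-filter; filter-none; filter-some)
open import Data.List.Membership.Propositional using (_∈_; _∉_; find; lose; mapWith∈)
open import Data.List.Membership.Propositional.Properties
  using ( ∈-allFin; ∈-filter⁺; ∈-filter⁻; ∈-++⁺ˡ; ∈-++⁺ʳ; ∈-map⁺; ∈-concatMap⁺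
        ; ∈-cartesianProductWith⁺; ∈-cartesianProductWith⁻)
open import Data.List.Membership.Propositional.Properties.WithK using (unique∧set⇒bag)
open import Data.List.Membership.Setoid.Properties using (length-mapWith∈)
open import Data.List.Relation.Unary.All as All using (All; []; _∷_)
open import Data.List.Relation.Unary.All.Properties using (¬Any⇒All¬; ¬All⇒Any¬)
open import Data.List.Relation.Unary.Any as Any using (Any; here; there)
open import Data.List.Relation.Unary.Any.Properties using (mapWith∈⁺; mapWith∈⁻) renaming (map⁺ to Any-map⁺)
open import Data.List.Relation.Unary.AllPairs using ([]; _∷_)
open import Data.List.Relation.Unary.Unique.Propositional using (Unique)
open import Data.List.Relation.Unary.Unique.Propositional.Properties
  using (allFin⁺; Unique[x∷xs]⇒x∉xs) renaming (filter⁺ to Unique-filter⁺)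
open import Data.List.Relation.Binary.BagAndSetEquality using (∼bag⇒↭)
open import Data.List.Relation.Binary.Permutation.Propositional.Properties using (↭-length)
open import Induction.WellFounded using (Acc; acc)
open import Relation.Binary.PropositionalEquality
  using (_≡_; _≢_; refl; sym; trans; cong; cong₂; subst; subst₂; setoid; module ≡-Reasoning)
open import Relation.Nullary using (¬_; Dec; yes; no; does; contradiction)
open import Relation.Nullary.Decidable using (_×-dec_; ¬?; map′; dec-true; decidable-stable)
open import Relation.Unary using (Pred; Decidable)

private
  variable
    a ℓ : Level
    A B : Set a

𝟙 : Dec A → ℕ
𝟙 (yes _) = 1
𝟙 (no  _) = 0

𝟙-yes : (d : Dec A) → A → 𝟙 d ≡ 1
𝟙-yes (yes _) _ = refl
𝟙-yes (no ¬x) x = contradiction x ¬x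

𝟙-no : (d : Dec A) → ¬ A → 𝟙 d ≡ 0
𝟙-no (yes x) ¬x = contradiction x ¬x
𝟙-no (no _)  _  = refl

module _ {P : Pred A ℓ} (P? : Decidable P) where

  length-filter-∷ : ∀ x xs → length (filter P? (x ∷ xs)) ≡ 𝟙 (P? x) + length (filter P? xs)
  length-filter-∷ x xs with P? x
  ... | yes _ = refl
  ... | no  _ = refl

  sum-map-𝟙 : ∀ xs → sum (map (λ x → 𝟙 (P? x)) xs) ≡ length (filter P? xs)
  sum-map-𝟙 []       = refl
  sum-map-𝟙 (x ∷ xs) = trans (cong (𝟙 (P? x) +_) (sum-map-𝟙 xs)) (sym (length-filter-∷ x xs))

  0<length-filter⇒Any : ∀ xs → 0 < length (filter P? xs) → Any P xs
  0<length-filter⇒Any (x ∷ xs) pos with P? x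
  ... | yes Px = here Px
  ... | no  _  = there (0<length-filter⇒Any xs pos)

sum-map-+ : ∀ (f g : A → ℕ) xs → sum (map (λ x → f x + g x) xs) ≡ sum (map f xs) + sum (map g xs)
sum-map-+ f g []       = refl
sum-map-+ f g (x ∷ xs) = trans (cong (f x + g x +_) (sum-map-+ f g xs)) (interchange (f x) (g x) _ _)

sum-map-∸ : ∀ {f g : A → ℕ} → (∀ x → g x ≤ f x) → ∀ xs →
  sum (map (λ x → f x ∸ g x) xs) + sum (map g xs) ≡ sum (map f xs)
sum-map-∸ {f = f} {g} g≤f xs =
  trans (sym (sum-map-+ (λ x → f x ∸ g x) g xs)) (cong sum (map-cong (λ x → m∸n+n≡m (g≤f x)) xs))

sum-map-const : ∀ c (xs : List A) → sum (map (λ _ → c) xs) ≡ length xs * c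
sum-map-const c []       = refl
sum-map-const c (_ ∷ xs) = cong (c +_) (sum-map-const c xs)

sum-map-comm : ∀ (F : A → B → ℕ) xs ys →
  sum (map (λ x → sum (map (F x) ys)) xs) ≡ sum (map (λ y → sum (map (λ x → F x y) xs)) ys)
sum-map-comm F []       ys = sym (trans (sum-map-const 0 ys) (*-zeroʳ (length ys)))
sum-map-comm F (x ∷ xs) ys =
  trans (cong (sum (map (F x) ys) +_) (sum-map-comm F xs ys)) (sym (sum-map-+ (F x) _ ys))

∈⇒≤sum-map : ∀ (f : A → ℕ) {x xs} → x ∈ xs → f x ≤ sum (map f xs)
∈⇒≤sum-map f (here refl) = m≤m+n _ _
∈⇒≤sum-map f (there x∈)  = ≤-trans (∈⇒≤sum-map f x∈) (m≤n+m _ _)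

0<sum-map⇒Any : ∀ (f : A → ℕ) xs → 0 < sum (map f xs) → Any (λ x → 0 < f x) xs
0<sum-map⇒Any f (x ∷ xs) pos with f x in fx≡
... | suc _ = here (subst (0 <_) (sym fx≡) z<s)
... | zero  = there (0<sum-map⇒Any f xs pos)

length≤sum-map : ∀ {f : A → ℕ} {xs} → All (λ x → 1 ≤ f x) xs → length xs ≤ sum (map f xs)
length≤sum-map []           = z≤n
length≤sum-map (1≤fx ∷ 1≤f) = +-mono-≤ 1≤fx (length≤sum-map 1≤f)

sum-map≤length : ∀ {f : A → ℕ} {xs} → All (λ x → f x ≤ 1) xs → sum (map f xs) ≤ length xs
sum-map≤length []           = z≤n
sum-map≤length (fx≤1 ∷ f≤1) = +-mono-≤ fx≤1 (sum-map≤length f≤1)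

unique∧set⇒length≡ : ∀ {xs ys : List A} → Unique xs → Unique ys → (∀ {x} → x ∈ xs ⇔ x ∈ ys) →
  length xs ≡ length ys
unique∧set⇒length≡ xs! ys! xs≈ys = ↭-length (∼bag⇒↭ (unique∧set⇒bag xs! ys! xs≈ys))

unique∧constant⇒length≤1 : ∀ {xs : List A} → Unique xs → (∀ {x y} → x ∈ xs → y ∈ xs → x ≡ y) →
  length xs ≤ 1
unique∧constant⇒length≤1 []              _        = z≤n
unique∧constant⇒length≤1 ([] ∷ [])       _        = ≤-refl
unique∧constant⇒length≤1 ((x≢y ∷ _) ∷ _) constant = contradiction (constant (here refl) (there (here refl))) x≢y

module _ {n : ℕ} where
  open import Data.List.Membership.DecPropositional (_≟_ {n = n}) using (_∈?_)

  unique⇒length≤ : ∀ {xs : List (Fin n)} → Unique xs → length xs ≤ n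
  unique⇒length≤ {xs} xs! = begin
    length xs                            ≡⟨ unique∧set⇒length≡ xs! (Unique-filter⁺ (_∈? xs) (allFin⁺ n)) sameMembers ⟩
    length (filter (_∈? xs) (allFin n))  ≤⟨ length-filter (_∈? xs) (allFin n) ⟩
    length (allFin n)                    ≡⟨ length-tabulate id ⟩
    n                                    ∎
    where
    open ≤-Reasoning
    sameMembers : ∀ {x} → x ∈ xs ⇔ x ∈ filter (_∈? xs) (allFin n)
    sameMembers = mk⇔ (∈-filter⁺ (_∈? xs) (∈-allFin _)) (proj₂ ∘ ∈-filter⁻ (_∈? xs) {xs = allFin n})

  sum-map-𝟙∈ : ∀ {P : Pred (Fin n) ℓ} (P? : Decidable P) {xs} → Unique xs →
    sum (map (λ x → 𝟙 (x ∈? xs)) (filter P? (allFin n))) ≡ length (filter P? xs)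
  sum-map-𝟙∈ P? {xs} xs! =
    trans (sum-map-𝟙 (_∈? xs) (filter P? (allFin n)))
          (unique∧set⇒length≡ (Unique-filter⁺ (_∈? xs) (Unique-filter⁺ P? (allFin⁺ n)))
                              (Unique-filter⁺ P? xs!)
                              (mk⇔ to from))
    where
    to : ∀ {x} → x ∈ filter (_∈? xs) (filter P? (allFin n)) → x ∈ filter P? xs
    to x∈ = let (x∈P , x∈xs) = ∈-filter⁻ (_∈? xs) {xs = filter P? (allFin n)} x∈
            in ∈-filter⁺ P? x∈xs (proj₂ (∈-filter⁻ P? {xs = allFin n} x∈P))
    from : ∀ {x} → x ∈ filter P? xs → x ∈ filter (_∈? xs) (filter P? (allFin n))
    from x∈ = let (x∈xs , Px) = ∈-filter⁻ P? {xs = xs} x∈ in ∈-filter⁺ (_∈? xs) (∈-filter⁺ P? (∈-allFin _) Px) x∈xs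

members : ∀ {n} → Subset n → List (Fin n)
members {n} C = filter (_∈ₛ? C) (allFin n)

∈-members⁺ : ∀ {n} {C : Subset n} {x} → x ∈ₛ C → x ∈ members C
∈-members⁺ {C = C} = ∈-filter⁺ (_∈ₛ? C) (∈-allFin _)

∈-members⁻ : ∀ {n} {C : Subset n} {x} → x ∈ members C → x ∈ₛ C
∈-members⁻ {C = C} = proj₂ ∘ ∈-filter⁻ (_∈ₛ? C) {xs = allFin _}

members-unique : ∀ {n} (C : Subset n) → Unique (members C)
members-unique {n} C = Unique-filter⁺ (_∈ₛ? C) (allFin⁺ n)

length-filter-∈-tabulate-suc : ∀ {n} x (C : Subset n) →
  length (filter (_∈ₛ? (x ∷ C)) (tabulate suc)) ≡ length (members C)
length-filter-∈-tabulate-suc {n} x C =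
  trans (cong (length ∘ filter (_∈ₛ? (x ∷ C))) (sym (map-tabulate id suc))) (shift (allFin n))
  where
  -- does (suc i ∈ₛ? x ∷ C) reduces to does (i ∈ₛ? C), so a single split advances both filters.
  shift : ∀ is → length (filter (_∈ₛ? (x ∷ C)) (map suc is)) ≡ length (filter (_∈ₛ? C) is)
  shift []       = refl
  shift (i ∷ is) with does (i ∈ₛ? C)
  ... | true  = cong suc (shift is)
  ... | false = shift is

length-members : ∀ {n} (C : Subset n) → length (members C) ≡ ∣ C ∣
length-members []            = refl
length-members (inside  ∷ C) = cong suc (trans (length-filter-∈-tabulate-suc inside C) (length-members C))
length-members (outside ∷ C) = trans (length-filter-∈-tabulate-suc outside C) (length-members C)

toSubset : ∀ {n} {P : Pred (Fin n) ℓ} → Decidable P → Subset n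
toSubset P? = Vec.tabulate (does ∘ P?)

module _ {n} {P : Pred (Fin n) ℓ} (P? : Decidable P) {x : Fin n} where

  ∈-toSubset⁺ : P x → x ∈ₛ toSubset P?
  ∈-toSubset⁺ Px = lookup⇒[]= x _ (trans (lookup∘tabulate (does ∘ P?) x) (dec-true (P? x) Px))

  ∈-toSubset⁻ : x ∈ₛ toSubset P? → P x
  ∈-toSubset⁻ x∈ with P? x | trans (sym ([]=⇒lookup x∈)) (lookup∘tabulate (does ∘ P?) x)
  ... | yes Px | _  = Px
  ... | no  _  | ()

module _ {P : Pred ℕ ℓ} (P? : Decidable P) where

  least : ∀ {n} → P n → Σ ℕ λ k → P k × (∀ {j} → P j → k ≤ j)
  least {n} = search (<-wellFounded n)
    where
    search : ∀ {n} → Acc _<_ n → P n → Σ ℕ λ k → P k × (∀ {j} → P j → k ≤ j)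
    search {n} (acc smaller) Pn with anyUpTo? P? n
    ... | yes (j , j<n , Pj) = search (smaller j<n) Pj
    ... | no  none           = n , Pn , λ Pj → ≮⇒≥ (λ j<n → none (_ , j<n , Pj))

  greatest : ∀ N {n} → (∀ {k} → P k → k ≤ N) → P n → Σ ℕ λ k → P k × (∀ {j} → P j → j ≤ k)
  greatest N bounded Pn with P? N
  ... | yes PN = N , PN , bounded
  greatest zero    bounded Pn | no ¬PN = contradiction (subst P (n≤0⇒n≡0 (bounded Pn)) Pn) ¬PN
  greatest (suc N) bounded Pn | no ¬PN =
    greatest N (λ Pk → s≤s⁻¹ (≤∧≢⇒< (bounded Pk) (λ k≡N → ¬PN (subst P k≡N Pk)))) Pn

listsOfLength : ℕ → List A → List (List A)
listsOfLength zero    xs = [] ∷ []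
listsOfLength (suc k) xs = cartesianProductWith _∷_ xs (listsOfLength k xs)

∈-listsOfLength⁺ : ∀ {xs : List A} → (∀ x → x ∈ xs) → ∀ ys → ys ∈ listsOfLength (length ys) xs
∈-listsOfLength⁺ complete []       = here refl
∈-listsOfLength⁺ complete (y ∷ ys) = ∈-cartesianProductWith⁺ _∷_ (complete y) (∈-listsOfLength⁺ complete ys)

∈-listsOfLength⁻ : ∀ k {xs ys : List A} → ys ∈ listsOfLength k xs → length ys ≡ k
∈-listsOfLength⁻ zero    (here refl) = refl
∈-listsOfLength⁻ (suc k) {xs} ys∈ with ∈-cartesianProductWith⁻ _∷_ xs (listsOfLength k xs) ys∈
... | _ , _ , _ , zs∈ , refl = cong suc (∈-listsOfLength⁻ k zs∈)

anyOfLength? : ∀ {P : Pred (List A) ℓ} → Decidable P → ∀ {xs} → (∀ x → x ∈ xs) →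
  ∀ k → Dec (Σ (List A) λ ys → P ys × length ys ≡ k)
anyOfLength? {A = A} {P = P} P? {xs} complete k =
  map′ sound (λ (ys , Pys , ys-length) → lose (∈-lists ys-length) Pys) (Any.any? P? (listsOfLength k xs))
  where
  sound : Any P (listsOfLength k xs) → Σ (List A) λ ys → P ys × length ys ≡ k
  sound found = let (ys , ys∈ , Pys) = find found in ys , Pys , ∈-listsOfLength⁻ k ys∈
  ∈-lists : ∀ {ys} → length ys ≡ k → ys ∈ listsOfLength k xs
  ∈-lists {ys} refl = ∈-listsOfLength⁺ complete ys

module _ (G : Graph) where
  open Graph G
  open import Data.List.Membership.DecPropositional (_≟_ {n = m}) using (_∈?_)

  infixr 5 _++ᵖ_
  _++ᵖ_ : ∀ {u v w} → Path G u v → Path G v w → Path G u w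
  []      ++ᵖ q = q
  (e ∷ p) ++ᵖ q = e ∷ (p ++ᵖ q)

  ∈-++ᵖ⁺ˡ : ∀ {u v w x} {p : Path G u v} (q : Path G v w) → x ∈ edges G p → x ∈ edges G (p ++ᵖ q)
  ∈-++ᵖ⁺ˡ {p = e ∷ p} q (here refl) = here refl
  ∈-++ᵖ⁺ˡ {p = e ∷ p} q (there x∈)  = there (∈-++ᵖ⁺ˡ q x∈)

  ∈-++ᵖ⁺ʳ : ∀ {u v w x} (p : Path G u v) {q : Path G v w} → x ∈ edges G q → x ∈ edges G (p ++ᵖ q)
  ∈-++ᵖ⁺ʳ []      x∈ = x∈
  ∈-++ᵖ⁺ʳ (e ∷ p) x∈ = there (∈-++ᵖ⁺ʳ p x∈)

  length-++ᵖ-∷[] : ∀ {u} e (p : Path G u (tl e)) → length (edges G (p ++ᵖ (e ∷ []))) ≡ suc (length (edges G p))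
  length-++ᵖ-∷[] e []      = refl
  length-++ᵖ-∷[] e (_ ∷ p) = cong suc (length-++ᵖ-∷[] e p)

  splitAtEdge : ∀ {u v e} (p : Path G u v) → e ∈ edges G p →
    Σ (Path G u (tl e)) λ a → Σ (Path G (hd e) v) λ b → p ≡ a ++ᵖ (e ∷ b)
  splitAtEdge (e ∷ p) (here refl) = [] , p , refl
  splitAtEdge (x ∷ p) (there e∈)  = let (a , b , p≡) = splitAtEdge p e∈ in x ∷ a , b , cong (x ∷_) p≡

  nonempty : ∀ {u v} → u ≢ v → (p : Path G u v) → Σ (Fin m) λ e → e ∈ edges G p
  nonempty u≢v []      = contradiction refl u≢v
  nonempty _   (e ∷ p) = e , here refl

  vertices : ∀ {u v} → Path G u v → List (Fin n)
  vertices {u} []      = u ∷ []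
  vertices     (e ∷ p) = tl e ∷ vertices p

  length-vertices : ∀ {u v} (p : Path G u v) → length (vertices p) ≡ suc (length (edges G p))
  length-vertices []      = refl
  length-vertices (e ∷ p) = cong suc (length-vertices p)

  prefixTo : ∀ {u v x} (p : Path G u v) → x ∈ vertices p → Path G u x
  prefixTo []      (here refl) = []
  prefixTo (e ∷ p) (here refl) = []
  prefixTo (e ∷ p) (there x∈)  = e ∷ prefixTo p x∈

  tl∈vertices : ∀ {u v e} (p : Path G u v) → e ∈ edges G p → tl e ∈ vertices p
  tl∈vertices (e ∷ p) (here refl) = here refl
  tl∈vertices (e ∷ p) (there e∈)  = there (tl∈vertices p e∈)

  Avoids : ∀ {u v} → Subset m → Path G u v → Set
  Avoids D p = All (_∉ₛ D) (edges G p)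

  avoids-++ᵖ : ∀ {D u v w} {p : Path G u v} {q : Path G v w} → Avoids D p → Avoids D q → Avoids D (p ++ᵖ q)
  avoids-++ᵖ {p = []}    []              q-avoids = q-avoids
  avoids-++ᵖ {p = e ∷ p} (e∉D ∷ p-avoids) q-avoids = e∉D ∷ avoids-++ᵖ p-avoids q-avoids

  crossingEdge : ∀ {T : Pred (Fin n) ℓ} → Decidable T → ∀ {u v} (p : Path G u v) → ¬ T u → T v →
    Σ (Fin m) λ e → e ∈ edges G p × ¬ T (tl e) × T (hd e)
  crossingEdge T? []      ¬Tu Tv = contradiction Tv ¬Tu
  crossingEdge T? (e ∷ p) ¬Tu Tv with T? (hd e)
  ... | yes Thd = e , here refl , ¬Tu , Thd
  ... | no ¬Thd = let (x , x∈p , crosses) = crossingEdge T? p ¬Thd Tv in x , there x∈p , crosses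

  emptyPaths : ∀ u v → List (Path G u v)
  emptyPaths u v with u ≟ v
  ... | yes refl = [] ∷ []
  ... | no  _    = []

  []∈emptyPaths : ∀ v → [] ∈ emptyPaths v v
  []∈emptyPaths v with v ≟ v
  ... | yes refl = here refl
  ... | no  v≢v  = contradiction refl v≢v

  prepend : ∀ e {u v} → List (Path G (hd e) v) → List (Path G u v)
  prepend e {u} ps with tl e ≟ u
  ... | yes refl = map (e ∷_) ps
  ... | no  _    = []

  ∈-prepend : ∀ e {v} {p : Path G (hd e) v} {ps} → p ∈ ps → (e ∷ p) ∈ prepend e ps
  ∈-prepend e p∈ with tl e ≟ tl e
  ... | yes refl = ∈-map⁺ (e ∷_) p∈
  ... | no  ≢tl  = contradiction refl ≢tl

  pathsWithin : ℕ → ∀ u v → List (Path G u v)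
  pathsWithin zero    u v = emptyPaths u v
  pathsWithin (suc d) u v = emptyPaths u v ++ concatMap (λ e → prepend e (pathsWithin d (hd e) v)) (allFin m)

  ∈-pathsWithin : ∀ d {u v} (p : Path G u v) → length (edges G p) ≤ d → p ∈ pathsWithin d u v
  ∈-pathsWithin zero    []      _        = []∈emptyPaths _
  ∈-pathsWithin (suc d) []      _        = ∈-++⁺ˡ ([]∈emptyPaths _)
  ∈-pathsWithin (suc d) (e ∷ p) (s≤s ≤d) =
    ∈-++⁺ʳ (emptyPaths _ _) (∈-concatMap⁺ _ (lose (∈-allFin e) (∈-prepend e (∈-pathsWithin d p ≤d))))

  edgesInto edgesOutOf : Fin n → List (Fin m)
  edgesInto  v = filter (λ e → hd e ≟ v) (allFin m)
  edgesOutOf v = filter (λ e → tl e ≟ v) (allFin m)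

  entering leaving : Fin n → ∀ {u w} → Path G u w → ℕ
  entering v p = length (filter (λ e → hd e ≟ v) (edges G p))
  leaving  v p = length (filter (λ e → tl e ≟ v) (edges G p))

  balance : ∀ {u w} (p : Path G u w) v → entering v p + 𝟙 (u ≟ v) ≡ leaving v p + 𝟙 (w ≟ v)
  balance []              v = refl
  balance {w = w} (e ∷ p) v = begin
    entering v (e ∷ p) + δtl  ≡⟨ cong (_+ δtl) (length-filter-∷ (λ x → hd x ≟ v) e (edges G p)) ⟩
    δhd + entering v p + δtl  ≡⟨ cong (_+ δtl) (+-comm δhd (entering v p)) ⟩
    entering v p + δhd + δtl  ≡⟨ cong (_+ δtl) (balance p v) ⟩
    leaving v p + δw + δtl    ≡⟨ +-comm (leaving v p + δw) δtl ⟩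
    δtl + (leaving v p + δw)  ≡⟨ +-assoc δtl (leaving v p) δw ⟨
    δtl + leaving v p + δw    ≡⟨ cong (_+ δw) (length-filter-∷ (λ x → tl x ≟ v) e (edges G p)) ⟨
    leaving v (e ∷ p) + δw    ∎
    where
    open ≡-Reasoning
    δhd δtl δw : ℕ
    δhd = 𝟙 (hd e ≟ v)
    δtl = 𝟙 (tl e ≟ v)
    δw  = 𝟙 (w ≟ v)

  pathFlow : ∀ {u v} → Path G u v → Fin m → ℕ
  pathFlow p e = 𝟙 (e ∈? edges G p)

  familyFlow : List (STPath G) → Fin m → ℕ
  familyFlow ps e = onCount G e ps

  onCount-∷ : ∀ e p ps → onCount G e (p ∷ ps) ≡ pathFlow p e + onCount G e ps
  onCount-∷ e = length-filter-∷ (λ q → e ∈? edges G q)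

  onCount≡sum : ∀ e ps → onCount G e ps ≡ sum (map (λ p → pathFlow p e) ps)
  onCount≡sum e ps = sym (sum-map-𝟙 (λ p → e ∈? edges G p) ps)

  Any⇒0<onCount : ∀ {e} ps → Any (λ p → e ∈ edges G p) ps → 0 < onCount G e ps
  Any⇒0<onCount {e} ps = filter-some (λ p → e ∈? edges G p)

  0<onCount⇒Any : ∀ {e} ps → 0 < onCount G e ps → Any (λ p → e ∈ edges G p) ps
  0<onCount⇒Any {e} = 0<length-filter⇒Any (λ p → e ∈? edges G p)

  familyFlowCover : ∀ ps → FlowCover G (familyFlow ps) ps
  familyFlowCover ps e = 0<onCount⇒Any ps , ≤-refl

  flowCover⇒covers : ∀ {f ps} → Positive G f → FlowCover G f ps → Covers G ps
  flowCover⇒covers f>0 cover e = proj₁ (cover e) (f>0 e)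

  covers? : ∀ ps → Dec (Covers G ps)
  covers? ps = Finₚ.all? λ e → Any.any? (λ p → e ∈? edges G p) ps

  crossings : Subset m → STPath G → ℕ
  crossings C q = length (filter (_∈? edges G q) (members C))

  sum-onCount : ∀ C qs → sum (map (λ e → onCount G e qs) (members C)) ≡ sum (map (crossings C) qs)
  sum-onCount C qs = begin
    sum (map (λ e → onCount G e qs) (members C))
      ≡⟨ cong sum (map-cong (λ e → onCount≡sum e qs) (members C)) ⟩
    sum (map (λ e → sum (map (λ q → pathFlow q e) qs)) (members C))
      ≡⟨ sum-map-comm (λ e q → pathFlow q e) (members C) qs ⟩
    sum (map (λ q → sum (map (pathFlow q) (members C))) qs)
      ≡⟨ cong sum (map-cong (λ q → sum-map-𝟙 (_∈? edges G q) (members C)) qs) ⟩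
    sum (map (crossings C) qs)
      ∎
    where open ≡-Reasoning

  length≤sum-onCount : ∀ {C} → IsCutSet G C → ∀ qs → length qs ≤ sum (map (λ e → onCount G e qs) (members C))
  length≤sum-onCount {C} cut qs =
    subst (length qs ≤_) (sym (sum-onCount C qs)) (length≤sum-map {xs = qs} (All.tabulate λ {q} _ → crosses q))
    where
    crosses : ∀ q → 1 ≤ crossings C q
    crosses q = let (e , e∈q , e∈C) = cut q in filter-some (_∈? edges G q) (lose (∈-members⁺ e∈C) e∈q)

  ≤inflow : ∀ f e → f e ≤ inflow G f (hd e)
  ≤inflow f e = ∈⇒≤sum-map f (∈-filter⁺ (λ x → hd x ≟ hd e) (∈-allFin e) refl)

  ≤outflow : ∀ f e → f e ≤ outflow G f (tl e)
  ≤outflow f e = ∈⇒≤sum-map f (∈-filter⁺ (λ x → tl x ≟ tl e) (∈-allFin e) refl)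

  0<inflow⇒edge : ∀ {f v} → 0 < inflow G f v → Σ (Fin m) λ e → hd e ≡ v × 0 < f e
  0<inflow⇒edge {f} {v} pos =
    let (e , e∈ , fe>0) = find (0<sum-map⇒Any f (edgesInto v) pos)
    in e , proj₂ (∈-filter⁻ (λ x → hd x ≟ v) {xs = allFin m} e∈) , fe>0

  0<outflow⇒edge : ∀ {f v} → 0 < outflow G f v → Σ (Fin m) λ e → tl e ≡ v × 0 < f e
  0<outflow⇒edge {f} {v} pos =
    let (e , e∈ , fe>0) = find (0<sum-map⇒Any f (edgesOutOf v) pos)
    in e , proj₂ (∈-filter⁻ (λ x → tl x ≟ v) {xs = allFin m} e∈) , fe>0

  inflow-familyFlow : ∀ ps v → inflow G (familyFlow ps) v ≡ sum (map (λ p → inflow G (pathFlow p) v) ps)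
  inflow-familyFlow ps v =
    trans (cong sum (map-cong (λ e → onCount≡sum e ps) (edgesInto v)))
          (sum-map-comm (λ e p → pathFlow p e) (edgesInto v) ps)

  outflow-familyFlow : ∀ ps v → outflow G (familyFlow ps) v ≡ sum (map (λ p → outflow G (pathFlow p) v) ps)
  outflow-familyFlow ps v =
    trans (cong sum (map-cong (λ e → onCount≡sum e ps) (edgesOutOf v)))
          (sum-map-comm (λ e p → pathFlow p e) (edgesOutOf v) ps)

  flow-∸ : ∀ {f g} → IsFlow G f → IsFlow G g → (∀ e → g e ≤ f e) → IsFlow G (λ e → f e ∸ g e)
  flow-∸ {f} {g} f-flow g-flow g≤f v v≢s v≢t = +-cancelʳ-≡ (inflow G g v) _ _ (begin
    inflow G (λ e → f e ∸ g e) v + inflow G g v    ≡⟨ sum-map-∸ g≤f (edgesInto v) ⟩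
    inflow G f v                                   ≡⟨ f-flow v v≢s v≢t ⟩
    outflow G f v                                  ≡⟨ sum-map-∸ g≤f (edgesOutOf v) ⟨
    outflow G (λ e → f e ∸ g e) v + outflow G g v  ≡⟨ cong (outflow G (λ e → f e ∸ g e) v +_) (g-flow v v≢s v≢t) ⟨
    outflow G (λ e → f e ∸ g e) v + inflow G g v   ∎)
    where open ≡-Reasoning

  module _ (acyclic : Acyclic G) where

    tl∉vertices : ∀ e {w} (p : Path G (hd e) w) → tl e ∉ vertices p
    tl∉vertices e p tl∈ with acyclic (tl e) (e ∷ prefixTo p tl∈)
    ... | ()

    vertices-unique : ∀ {u v} (p : Path G u v) → Unique (vertices p)
    vertices-unique []      = [] ∷ []
    vertices-unique (e ∷ p) = ¬Any⇒All¬ (vertices p) (tl∉vertices e p) ∷ vertices-unique p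

    edges-unique : ∀ {u v} (p : Path G u v) → Unique (edges G p)
    edges-unique []      = []
    edges-unique (e ∷ p) = ¬Any⇒All¬ (edges G p) (tl∉vertices e p ∘ tl∈vertices p) ∷ edges-unique p

    disjoint-++ᵖ : ∀ {u v w x} (p : Path G u v) (q : Path G v w) → x ∈ edges G p → x ∉ edges G q
    disjoint-++ᵖ (e ∷ p) q (here refl) x∈q = Unique[x∷xs]⇒x∉xs (edges-unique (e ∷ (p ++ᵖ q))) (∈-++ᵖ⁺ʳ p x∈q)
    disjoint-++ᵖ (e ∷ p) q (there x∈p) x∈q = disjoint-++ᵖ p q x∈p x∈q

    length<n : ∀ {u v} (p : Path G u v) → length (edges G p) < n
    length<n p = subst (_≤ n) (length-vertices p) (unique⇒length≤ (vertices-unique p))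

    allPaths : ∀ u v → List (Path G u v)
    allPaths = pathsWithin n

    ∈-allPaths : ∀ {u v} (p : Path G u v) → p ∈ allPaths u v
    ∈-allPaths p = ∈-pathsWithin n p (<⇒≤ (length<n p))

    pathAlong? : ∀ {Q : Pred (Fin m) ℓ} → Decidable Q → ∀ u v → Dec (Σ (Path G u v) λ p → All Q (edges G p))
    pathAlong? Q? u v = map′ (λ found → let (p , _ , Qp) = find found in p , Qp)
                             (λ (p , Qp) → lose (∈-allPaths p) Qp)
                             (Any.any? (All.all? Q? ∘ edges G) (allPaths u v))

    private
      meets? : ∀ D (p : STPath G) → Dec (Any (_∈ₛ D) (edges G p))
      meets? D p = Any.any? (_∈ₛ? D) (edges G p)

      allMeet⇒cut : ∀ {D} → All (Any (_∈ₛ D) ∘ edges G) (allPaths s t) → IsCutSet G D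
      allMeet⇒cut all p = find (All.lookup all (∈-allPaths p))

    cut? : ∀ D → Dec (IsCutSet G D)
    cut? D = map′ allMeet⇒cut (λ cut → All.tabulate λ {p} _ → let (e , e∈p , e∈D) = cut p in lose e∈p e∈D)
                  (All.all? (meets? D) (allPaths s t))

    ¬cut⇒avoidingPath : ∀ {D} → ¬ IsCutSet G D → Σ (STPath G) (Avoids D)
    ¬cut⇒avoidingPath {D} ¬cut =
      let (p , _ , ¬meets) = find (¬All⇒Any¬ (meets? D) (allPaths s t) (¬cut ∘ allMeet⇒cut))
      in p , ¬Any⇒All¬ (edges G p) ¬meets

    minimal? : ∀ C → Dec (IsMinimalCutSet G C)
    minimal? C = map′ (λ (cut , none) → cut , λ D D⊂C D-cut → none (D , D⊂C , D-cut))
                      (λ (cut , minimal) → cut , λ (D , D⊂C , D-cut) → minimal D D⊂C D-cut)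
                      (cut? C ×-dec ¬? (anySubset? λ D → (D ⊂? C) ×-dec cut? D))

    minimalCutWithin : ∀ {X} → IsCutSet G X → Σ (Subset m) λ C → C ⊆ X × IsMinimalCutSet G C
    minimalCutWithin {X} = shrink (<-wellFounded ∣ X ∣)
      where
      shrink : ∀ {X} → Acc _<_ ∣ X ∣ → IsCutSet G X → Σ (Subset m) λ C → C ⊆ X × IsMinimalCutSet G C
      shrink {X} (acc smaller) X-cut with anySubset? (λ D → (D ⊂? X) ×-dec cut? D)
      ... | yes (D , D⊂X , D-cut) =
            let (C , C⊆D , C-minimal) = shrink (smaller (p⊂q⇒∣p∣<∣q∣ D⊂X)) D-cut
            in C , (λ x∈C → p⊂q⇒p⊆q D⊂X (C⊆D x∈C)) , C-minimal
      ... | no  none = X , (λ x∈X → x∈X) , X-cut , λ D D⊂X D-cut → none (D , D⊂X , D-cut)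

    inflow-pathFlow : ∀ {u w} (p : Path G u w) v → inflow G (pathFlow p) v ≡ entering v p
    inflow-pathFlow p v = sum-map-𝟙∈ (λ e → hd e ≟ v) (edges-unique p)

    outflow-pathFlow : ∀ {u w} (p : Path G u w) v → outflow G (pathFlow p) v ≡ leaving v p
    outflow-pathFlow p v = sum-map-𝟙∈ (λ e → tl e ≟ v) (edges-unique p)

    pathFlow-isFlow : ∀ (p : STPath G) → IsFlow G (pathFlow p)
    pathFlow-isFlow p v v≢s v≢t = begin
      inflow G (pathFlow p) v   ≡⟨ inflow-pathFlow p v ⟩
      entering v p              ≡⟨ +-cancelʳ-≡ 0 _ _ interior ⟩
      leaving v p               ≡⟨ outflow-pathFlow p v ⟨
      outflow G (pathFlow p) v  ∎
      where
      open ≡-Reasoning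
      interior : entering v p + 0 ≡ leaving v p + 0
      interior = subst₂ (λ i j → entering v p + i ≡ leaving v p + j)
                        (𝟙-no (s ≟ v) (v≢s ∘ sym)) (𝟙-no (t ≟ v) (v≢t ∘ sym)) (balance p v)

    familyFlow-isFlow : ∀ ps → IsFlow G (familyFlow ps)
    familyFlow-isFlow ps v v≢s v≢t = begin
      inflow G (familyFlow ps) v                     ≡⟨ inflow-familyFlow ps v ⟩
      sum (map (λ p → inflow G (pathFlow p) v) ps)   ≡⟨ cong sum (map-cong (λ p → pathFlow-isFlow p v v≢s v≢t) ps) ⟩
      sum (map (λ p → outflow G (pathFlow p) v) ps)  ≡⟨ outflow-familyFlow ps v ⟨
      outflow G (familyFlow ps) v                    ∎
      where open ≡-Reasoning

    module _ (noEdgeIntoS : ∀ e → hd e ≢ s) (noEdgeOutOfT : ∀ e → tl e ≢ t) (s≢t : s ≢ t)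
             (onSTPath : EveryEdgeOnSTPath G) where

      inflow-s : ∀ f → inflow G f s ≡ 0
      inflow-s f = cong (sum ∘ map f)
        (filter-none (λ e → hd e ≟ s) {xs = allFin m} (All.tabulate λ {e} _ → noEdgeIntoS e))

      outflow-t : ∀ f → outflow G f t ≡ 0
      outflow-t f = cong (sum ∘ map f)
        (filter-none (λ e → tl e ≟ t) {xs = allFin m} (All.tabulate λ {e} _ → noEdgeOutOfT e))

      outflow-pathFlow-s : ∀ (p : STPath G) → outflow G (pathFlow p) s ≡ 1
      outflow-pathFlow-s p = begin
        outflow G (pathFlow p) s   ≡⟨ outflow-pathFlow p s ⟩
        leaving s p                ≡⟨ +-identityʳ _ ⟨
        leaving s p + 0            ≡⟨ cong (leaving s p +_) (𝟙-no (t ≟ s) (s≢t ∘ sym)) ⟨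
        leaving s p + 𝟙 (t ≟ s)    ≡⟨ balance p s ⟨
        entering s p + 𝟙 (s ≟ s)   ≡⟨ cong₂ _+_ nothingEnters-s (𝟙-yes (s ≟ s) refl) ⟩
        1                          ∎
        where
        open ≡-Reasoning
        nothingEnters-s : entering s p ≡ 0
        nothingEnters-s = trans (sym (inflow-pathFlow p s)) (inflow-s _)

      value-familyFlow : ∀ ps → outflow G (familyFlow ps) s ≡ length ps
      value-familyFlow ps = begin
        outflow G (familyFlow ps) s                    ≡⟨ outflow-familyFlow ps s ⟩
        sum (map (λ p → outflow G (pathFlow p) s) ps)  ≡⟨ cong sum (map-cong outflow-pathFlow-s ps) ⟩
        sum (map (λ _ → 1) ps)                         ≡⟨ sum-map-const 1 ps ⟩
        length ps * 1                                  ≡⟨ *-identityʳ _ ⟩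
        length ps                                      ∎
        where open ≡-Reasoning

      module _ {f} (f-flow : IsFlow G f) where

        walkToSink : ∀ fuel {v} (walked : Path G s v) → n ≤ length (edges G walked) + fuel →
          v ≡ t ⊎ 0 < outflow G f v → Σ (Path G v t) λ q → All (λ e → 0 < f e) (edges G q)
        walkToSink zero       walked tooLong _              =
          contradiction (subst (n ≤_) (+-identityʳ _) tooLong) (<⇒≱ (length<n walked))
        walkToSink (suc _)    _      _       (inj₁ refl)    = [] , []
        walkToSink (suc fuel) walked tooLong (inj₂ out>0)   with 0<outflow⇒edge out>0
        ... | e , refl , fe>0 =
          let (q , q>0) = walkToSink fuel (walked ++ᵖ (e ∷ [])) longer continue
          in e ∷ q , fe>0 ∷ q>0
          where
          longer : n ≤ length (edges G (walked ++ᵖ (e ∷ []))) + fuel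
          longer = subst (n ≤_) (trans (+-suc _ fuel) (cong (_+ fuel) (sym (length-++ᵖ-∷[] e walked)))) tooLong
          continue : hd e ≡ t ⊎ 0 < outflow G f (hd e)
          continue with hd e ≟ t
          ... | yes hd≡t = inj₁ hd≡t
          ... | no  hd≢t = inj₂ (subst (0 <_) (f-flow (hd e) (noEdgeIntoS e) hd≢t) (≤-trans fe>0 (≤inflow f e)))

        positivePath : 0 < outflow G f s → Σ (STPath G) λ p → All (λ e → 0 < f e) (edges G p)
        positivePath value>0 = walkToSink n [] ≤-refl (inj₂ value>0)

        walkToSource : ∀ fuel {v} (walked : Path G v t) → n ≤ length (edges G walked) + fuel →
          0 < outflow G f v → 0 < outflow G f s
        walkToSource zero       walked tooLong _ =
          contradiction (subst (n ≤_) (+-identityʳ _) tooLong) (<⇒≱ (length<n walked))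
        walkToSource (suc fuel) {v} walked tooLong out>0 with v ≟ s | v ≟ t
        ... | yes refl | _        = out>0
        ... | no  _    | yes refl = contradiction (outflow-t f) (>⇒≢ out>0)
        ... | no  v≢s  | no  v≢t  with 0<inflow⇒edge (subst (0 <_) (sym (f-flow v v≢s v≢t)) out>0)
        ...   | e , refl , fe>0 =
          walkToSource fuel (e ∷ walked) (subst (n ≤_) (+-suc _ fuel) tooLong) (≤-trans fe>0 (≤outflow f e))

        0<flow⇒0<value : ∀ {e} → 0 < f e → 0 < outflow G f s
        0<flow⇒0<value {e} fe>0 =
          let (p , e∈p) = onSTPath e
              (_ , suffix , _) = splitAtEdge p e∈p
          in walkToSource n (e ∷ suffix) (m≤n+m n _) (≤-trans fe>0 (≤outflow f e))

        module _ (p : STPath G) (p>0 : All (λ e → 0 < f e) (edges G p)) where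

          pathFlow≤ : ∀ e → pathFlow p e ≤ f e
          pathFlow≤ e with e ∈? edges G p
          ... | yes e∈p = All.lookup p>0 e∈p
          ... | no  _   = z≤n

          residual : Fin m → ℕ
          residual e = f e ∸ pathFlow p e

          residual-isFlow : IsFlow G residual
          residual-isFlow = flow-∸ f-flow (pathFlow-isFlow p) pathFlow≤

          value-residual : suc (outflow G residual s) ≡ outflow G f s
          value-residual = begin
            suc (outflow G residual s)                       ≡⟨ +-comm 1 _ ⟩
            outflow G residual s + 1                         ≡⟨ cong (outflow G residual s +_) (outflow-pathFlow-s p) ⟨
            outflow G residual s + outflow G (pathFlow p) s  ≡⟨ sum-map-∸ pathFlow≤ (edgesOutOf s) ⟩
            outflow G f s                                    ∎
            where open ≡-Reasoning

      decompose : ∀ {f} → IsFlow G f →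
        Σ (List (STPath G)) λ ps → length ps ≡ outflow G f s × (∀ e → onCount G e ps ≡ f e)
      decompose f-flow = byValue _ f-flow refl
        where
        byValue : ∀ K {f} → IsFlow G f → outflow G f s ≡ K →
          Σ (List (STPath G)) λ ps → length ps ≡ K × (∀ e → onCount G e ps ≡ f e)
        byValue zero    f-flow value≡0 =
          [] , refl , λ e → sym (n≤0⇒n≡0 (≮⇒≥ λ fe>0 → >⇒≢ (0<flow⇒0<value f-flow fe>0) value≡0))
        byValue (suc K) f-flow value≡1+K =
          let (p , p>0) = positivePath f-flow (subst (0 <_) (sym value≡1+K) z<s)
              (ps , length≡K , ps≗residual) = byValue K (residual-isFlow f-flow p p>0)
                                                        (suc-injective (trans (value-residual f-flow p p>0) value≡1+K))
          in p ∷ ps , cong suc length≡K , λ e →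
               trans (onCount-∷ e p ps)
                     (trans (cong (pathFlow p e +_) (ps≗residual e)) (m+[n∸m]≡n (pathFlow≤ f-flow p p>0 e)))

      edgewiseCover : Covers G (map (proj₁ ∘ onSTPath) (allFin m))
      edgewiseCover e = Any-map⁺ (lose (∈-allFin e) (proj₂ (onSTPath e)))

      width : Σ ℕ (IsWidth G)
      width = let (w , cover , minimum) = least (anyOfLength? covers? ∈-allPaths) (_ , edgewiseCover , refl)
              in w , cover , λ qs covers → minimum (qs , covers , refl)

      widthTheorem : Σ ℕ λ w → IsWidth G w
          × (Σ (Fin m → ℕ) λ f → IsFlow G f × Positive G f × IsFwidth G f w)
          × (∀ f k → IsFlow G f → Positive G f → IsFwidth G f k → w ≤ k)
      widthTheorem with width
      ... | w , isWidth@((ps , cover , length≡w) , minimum) =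
        w , isWidth
          , (familyFlow ps , familyFlow-isFlow ps , ps-positive , (ps , familyFlowCover ps , length≡w)
            , λ qs → minimum qs ∘ flowCover⇒covers ps-positive)
          , λ _ _ _ f>0 ((qs , cover′ , qs-length) , _) →
              subst (w ≤_) qs-length (minimum qs (flowCover⇒covers f>0 cover′))
        where
        ps-positive : Positive G (familyFlow ps)
        ps-positive e = Any⇒0<onCount ps (cover e)

      shorterFlowCover : ∀ {f qs} → FlowCover G f qs →
        (p : STPath G) → All (λ e → 2 ≤ onCount G e qs) (edges G p) →
        Σ (List (STPath G)) λ ps → FlowCover G f ps × suc (length ps) ≡ length qs
      shorterFlowCover {f} {qs} cover p heavy =
        let (ps , length≡ , ps≗residual) = decompose (residual-isFlow (familyFlow-isFlow qs) p p>0)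
        in ps , stillCovers ps≗residual
              , trans (cong suc length≡) (trans (value-residual (familyFlow-isFlow qs) p p>0) (value-familyFlow qs))
        where
        p>0 : All (λ e → 0 < onCount G e qs) (edges G p)
        p>0 = All.map (≤-trans (s≤s z≤n)) heavy
        residual>0 : ∀ e → 0 < onCount G e qs → 0 < onCount G e qs ∸ pathFlow p e
        residual>0 e e-used with e ∈? edges G p
        ... | yes e∈p = m<n⇒0<n∸m (All.lookup heavy e∈p)
        ... | no  _   = e-used
        stillCovers : ∀ {ps} → (∀ e → onCount G e ps ≡ onCount G e qs ∸ pathFlow p e) → FlowCover G f ps
        stillCovers {ps} ps≗residual e =
            (λ fe>0 → 0<onCount⇒Any ps (subst (0 <_) (sym (ps≗residual e))
                                                  (residual>0 e (Any⇒0<onCount qs (proj₁ (cover e) fe>0)))))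
          , subst (_≤ f e) (sym (ps≗residual e)) (≤-trans (m∸n≤m (onCount G e qs) (pathFlow p e)) (proj₂ (cover e)))

      lightMinimalCut : ∀ (g : Fin m → ℕ) → ¬ (Σ (STPath G) λ p → All (λ e → 2 ≤ g e) (edges G p)) →
        Σ (Subset m) λ C → IsMinimalCutSet G C × (∀ {e} → e ∈ₛ C → g e ≤ 1)
      lightMinimalCut g noHeavyPath =
        let (C , C⊆X , C-minimal) = minimalCutWithin X-cut
        in C , C-minimal , λ e∈C → crossing⇒light (∈-toSubset⁻ crosses? (C⊆X e∈C))
        where
        Heavy : Fin n → Set
        Heavy v = Σ (Path G v t) λ q → All (λ e → 2 ≤ g e) (edges G q)
        heavy? : Decidable Heavy
        heavy? v = pathAlong? (λ e → 2 ≤? g e) v t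
        Crossing : Fin m → Set
        Crossing e = ¬ Heavy (tl e) × Heavy (hd e)
        crosses? : Decidable Crossing
        crosses? e = ¬? (heavy? (tl e)) ×-dec heavy? (hd e)
        X-cut : IsCutSet G (toSubset crosses?)
        X-cut p = let (e , e∈p , crossing) = crossingEdge heavy? p noHeavyPath ([] , [])
                  in e , e∈p , ∈-toSubset⁺ crosses? crossing
        crossing⇒light : ∀ {e} → Crossing e → g e ≤ 1
        crossing⇒light {e} (tl-light , q , q-heavy) = s≤s⁻¹ (≰⇒> λ 2≤ge → tl-light (e ∷ q , 2≤ge ∷ q-heavy))

      fwidth≤maxCut : ∀ {P f k} → (∀ C → IsMinimalCutSet G C → ∣ C ∣ ≤ P) → IsFwidth G f k → k ≤ P
      fwidth≤maxCut {P} maxCut ((qs , cover , refl) , minimum) with pathAlong? (λ e → 2 ≤? onCount G e qs) s t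
      ... | yes (p , heavy) =
            let (ps , cover′ , shorter) = shorterFlowCover cover p heavy
            in contradiction (minimum ps cover′) (<⇒≱ (≤-reflexive shorter))
      ... | no noHeavyPath =
            let (C , C-minimal , light) = lightMinimalCut (familyFlow qs) noHeavyPath
            in begin
              length qs                                      ≤⟨ length≤sum-onCount (proj₁ C-minimal) qs ⟩
              sum (map (λ e → onCount G e qs) (members C))   ≤⟨ sum-map≤length (All.tabulate (light ∘ ∈-members⁻)) ⟩
              length (members C)                             ≡⟨ length-members C ⟩
              ∣ C ∣                                           ≤⟨ maxCut C C-minimal ⟩
              P                                              ∎
        where open ≤-Reasoning

      wholeCut : IsCutSet G ⊤
      wholeCut p = let (e , e∈p) = nonempty s≢t p in e , e∈p , ∈⊤

      module _ {C : Subset m} (C-minimal : IsMinimalCutSet G C) where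

        OnlyCrossingAt : Fin m → ∀ {u v} → Path G u v → Set
        OnlyCrossingAt e p = ∀ {x} → x ∈ edges G p → x ∈ₛ C → x ≡ e

        avoidsRemoval⇒onlyCrossingAt : ∀ {e u v} {p : Path G u v} → Avoids (C - e) p → OnlyCrossingAt e p
        avoidsRemoval⇒onlyCrossingAt p-avoids x∈p x∈C =
          decidable-stable (_ ≟ _) λ x≢e → All.lookup p-avoids x∈p (x∈p∧x≢y⇒x∈p-y x∈C x≢e)

        noAvoidingSTPath : ∀ {p : STPath G} → ¬ Avoids C p
        noAvoidingSTPath {p} p-avoids = let (x , x∈p , x∈C) = proj₁ C-minimal p in All.lookup p-avoids x∈p x∈C

        privatePath : ∀ {e} → e ∈ₛ C → Σ (STPath G) λ p → e ∈ edges G p × OnlyCrossingAt e p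
        privatePath {e} e∈C with ¬cut⇒avoidingPath (proj₂ C-minimal (C - e) (x∈p⇒p-x⊂p e∈C))
        ... | p , p-avoids =
          let only = avoidsRemoval⇒onlyCrossingAt p-avoids
              (x , x∈p , x∈C) = proj₁ C-minimal p
          in p , subst (_∈ edges G p) (only x∈p x∈C) x∈p , only

        onlyCrossingAt⇒avoids : ∀ {e u v w x} {p : Path G u v} {q : Path G w x} → OnlyCrossingAt e p →
          (∀ {y} → y ∈ edges G q → y ∈ edges G p) → e ∉ edges G q → Avoids C q
        onlyCrossingAt⇒avoids {q = q} only q⊆p e∉q =
          All.tabulate λ y∈q y∈C → e∉q (subst (_∈ edges G q) (only (q⊆p y∈q) y∈C) y∈q)

        Escape : Fin n → Set
        Escape v = Σ (Path G v t) (Avoids C)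

        escapeAfter : ∀ {e} → e ∈ₛ C → Escape (hd e)
        escapeAfter {e} e∈C with privatePath e∈C
        ... | p , e∈p , only with splitAtEdge p e∈p
        ...   | a , b , refl =
          b , onlyCrossingAt⇒avoids only (λ y∈b → ∈-++ᵖ⁺ʳ a (there y∈b))
                                         (Unique[x∷xs]⇒x∉xs (edges-unique (e ∷ b)))

        -- If x lies on a path p meeting C only in e and tl x escapes, then x comes after e on p:
        -- otherwise the part of p before x followed by the escape would be an s-t path avoiding C.
        escapeContinues : ∀ {e x} {p : STPath G} → OnlyCrossingAt e p → x ∈ edges G p →
          Escape (tl x) → Σ (Path G (hd x) t) λ b → Avoids C (x ∷ b)
        escapeContinues {e} {x} {p} only x∈p (r , r-avoids) with splitAtEdge p x∈p
        ... | a , b , refl with e ∈? edges G a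
        ...   | yes e∈a = b , onlyCrossingAt⇒avoids only (∈-++ᵖ⁺ʳ a) (disjoint-++ᵖ a (x ∷ b) e∈a)
        ...   | no  e∉a =
          ⊥-elim (noAvoidingSTPath (avoids-++ᵖ (onlyCrossingAt⇒avoids only (∈-++ᵖ⁺ˡ (x ∷ b)) e∉a) r-avoids))

        OnPrivatePath : Fin m → Set
        OnPrivatePath x = Σ (Fin m) λ e → Σ (e ∈ₛ C) λ e∈C → x ∈ edges G (proj₁ (privatePath e∈C))

        onPrivatePaths⇒avoids : ∀ {u} (q : Path G u t) → All OnPrivatePath (edges G q) → Escape u → Avoids C q
        onPrivatePaths⇒avoids []      []                        _ = []
        onPrivatePaths⇒avoids (x ∷ q) ((_ , e∈C , x∈p) ∷ q-private) r
          with escapeContinues (proj₂ (proj₂ (privatePath e∈C))) x∈p r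
        ... | b , (x∉C ∷ b-avoids) = x∉C ∷ onPrivatePaths⇒avoids q q-private (b , b-avoids)

        onPrivatePaths⇒crossesOnce : ∀ {u} (q : Path G u t) → All OnPrivatePath (edges G q) →
          ∀ {x y} → x ∈ edges G q → y ∈ edges G q → x ∈ₛ C → y ∈ₛ C → x ≡ y
        onPrivatePaths⇒crossesOnce (z ∷ q) (_ ∷ q-private) x∈ y∈ x∈C y∈C with z ∈ₛ? C
        ... | yes z∈C = trans (isZ x∈ x∈C) (sym (isZ y∈ y∈C))
          where
          isZ : ∀ {w} → w ∈ z ∷ edges G q → w ∈ₛ C → w ≡ z
          isZ (here w≡z)  _   = w≡z
          isZ (there w∈q) w∈C = contradiction w∈C (All.lookup (onPrivatePaths⇒avoids q q-private (escapeAfter z∈C)) w∈q)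
        ... | no  z∉C = onPrivatePaths⇒crossesOnce q q-private (skip x∈ x∈C) (skip y∈ y∈C) x∈C y∈C
          where
          skip : ∀ {w} → w ∈ z ∷ edges G q → w ∈ₛ C → w ∈ edges G q
          skip (here refl)  w∈C = contradiction w∈C z∉C
          skip (there w∈q) _    = w∈q

        onPrivatePaths⇒crossings≤1 : ∀ (q : STPath G) → All OnPrivatePath (edges G q) → crossings C q ≤ 1
        onPrivatePaths⇒crossings≤1 q q-private =
          unique∧constant⇒length≤1 (Unique-filter⁺ (_∈? edges G q) (members-unique C)) λ x∈ y∈ →
            let (x∈C , x∈q) = ∈-filter⁻ (_∈? edges G q) {xs = members C} x∈
                (y∈C , y∈q) = ∈-filter⁻ (_∈? edges G q) {xs = members C} y∈
            in onPrivatePaths⇒crossesOnce q q-private x∈q y∈q (∈-members⁻ x∈C) (∈-members⁻ y∈C)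

        privateFamily : List (STPath G)
        privateFamily = mapWith∈ (members C) λ e∈ → proj₁ (privatePath (∈-members⁻ e∈))

        privateFlow : Fin m → ℕ
        privateFlow = familyFlow privateFamily

        fwidth-privateFlow : IsFwidth G privateFlow ∣ C ∣
        fwidth-privateFlow = (privateFamily , familyFlowCover privateFamily , length-privateFamily) , lowerBound
          where
          length-privateFamily : length privateFamily ≡ ∣ C ∣
          length-privateFamily = trans (length-mapWith∈ (setoid (Fin m)) (members C)) (length-members C)
          used-on-C : ∀ {e} → e ∈ₛ C → 0 < privateFlow e
          used-on-C e∈C = Any⇒0<onCount privateFamily
            (mapWith∈⁺ _ (_ , ∈-members⁺ e∈C , proj₁ (proj₂ (privatePath (∈-members⁻ (∈-members⁺ e∈C))))))
          supported : ∀ {x} → 0 < privateFlow x → OnPrivatePath x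
          supported x-used =
            let (e , e∈ , x∈p) = mapWith∈⁻ (members C) _ (0<onCount⇒Any privateFamily x-used)
            in e , ∈-members⁻ e∈ , x∈p
          lowerBound : ∀ qs → FlowCover G privateFlow qs → ∣ C ∣ ≤ length qs
          lowerBound qs cover = begin
            ∣ C ∣                                           ≡⟨ length-members C ⟨
            length (members C)                             ≤⟨ length≤sum-map (All.tabulate covered) ⟩
            sum (map (λ e → onCount G e qs) (members C))   ≡⟨ sum-onCount C qs ⟩
            sum (map (crossings C) qs)                     ≤⟨ sum-map≤length (All.tabulate crossesOnce) ⟩
            length qs                                      ∎
            where
            open ≤-Reasoning
            covered : ∀ {e} → e ∈ members C → 1 ≤ onCount G e qs
            covered e∈ = Any⇒0<onCount qs (proj₁ (cover _) (used-on-C (∈-members⁻ e∈)))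
            crossesOnce : ∀ {q} → q ∈ qs → crossings C q ≤ 1
            crossesOnce q∈ = onPrivatePaths⇒crossings≤1 _ (All.tabulate λ x∈q →
              supported (≤-trans (Any⇒0<onCount qs (lose q∈ x∈q)) (proj₂ (cover _))))

      parallelWidth : Σ ℕ (IsParallelWidth G)
      parallelWidth =
        let (P , largest , maximum) =
              greatest minimalOfSize? m (λ (C , _ , ∣C∣≡k) → subst (_≤ m) ∣C∣≡k (∣p∣≤n C))
                                        (_ , proj₂ (proj₂ (minimalCutWithin wholeCut)) , refl)
        in P , largest , λ C C-minimal → maximum (C , C-minimal , refl)
        where
        minimalOfSize? : ∀ k → Dec (Σ (Subset m) λ C → IsMinimalCutSet G C × ∣ C ∣ ≡ k)
        minimalOfSize? k = anySubset? λ C → minimal? C ×-dec (∣ C ∣ ℕₚ.≟ k)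

      parallelWidthTheorem : Σ ℕ λ P → IsParallelWidth G P
          × (Σ (Fin m → ℕ) λ f → IsFlow G f × IsFwidth G f P)
          × (∀ f k → IsFlow G f → IsFwidth G f k → k ≤ P)
      parallelWidthTheorem with parallelWidth
      ... | P , isPW@((C , C-minimal , ∣C∣≡P) , maxCut) =
        P , isPW
          , ( privateFlow C-minimal
            , familyFlow-isFlow (privateFamily C-minimal)
            , subst (IsFwidth G _) ∣C∣≡P (fwidth-privateFlow C-minimal))
          , λ _ _ _ → fwidth≤maxCut maxCut

lemma4 : (G : Graph) → IsSTDAG G →
    (Σ ℕ λ w → IsWidth G w
      × (Σ (Fin (Graph.m G) → ℕ) λ f → IsFlow G f × Positive G f × IsFwidth G f w)
      × (∀ f k → IsFlow G f → Positive G f → IsFwidth G f k → w ≤ k))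
    × (Σ ℕ λ p → IsParallelWidth G p
      × (Σ (Fin (Graph.m G) → ℕ) λ f → IsFlow G f × IsFwidth G f p)
      × (∀ f k → IsFlow G f → IsFwidth G f k → k ≤ p))
lemma4 G (acyclic , (noEdgeIntoS , _) , (noEdgeOutOfT , _) , onSTPath , s≢t) =
    widthTheorem         G acyclic noEdgeIntoS noEdgeOutOfT s≢t onSTPath
  , parallelWidthTheorem G acyclic noEdgeIntoS noEdgeOutOfT s≢t onSTPath
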